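{- Let $M$ and $N$ be matroids on disjoint finite sets $S$ and $T$. Let $M_q$ be a quotient of $M$ with $r(M)-r(M_q)=i$, and let $N^l$ be a lift of $N$. Set $Q=M_q\oplus N$ and $L=M\oplus N^l$ (matroids on $S\cup T$). Then (1) $Q$ is a quotient of $L$, and (2) the Higgs lift $H^i_{Q,L}$ is a semidirect sum of $M$ and $N$.
   Context: A quotient of a matroid $L$ on $E$ is a matroid $Q$ on $E$ such that $\mathrm{cl}_L(F)\subseteq\mathrm{cl}_Q(F)$ for all $F\subseteq E$; then $L$ is called a lift of $Q$. If $Q$ is a quotient of $L$ and $0\le i\le r(L)-r(Q)$, the $i$-th Higgs lift $H^i_{Q,L}$ of $Q$ toward $L$ is the matroid on $E$ with rank function $r(W)=\min\{r_Q(W)+i,\,r_L(W)\}$; for $i<0$ one sets $H^i_{Q,L}=Q$ and for $i>r(L)-r(Q)$ one sets $H^i_{Q,L}=L$. A semidirect sum of matroids $M$ on $S$ and $N$ on $T$ is a matroid $K$ on $S\cup T$ with $K|S=M$ and $K/S=N$. -}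

module Defs where

open import Data.Nat using (ℕ; _+_; _∸_; _≤_; _⊓_; _≤ᵇ_)
open import Data.Bool using (if_then_else_)
open import Data.Fin using (Fin)
open import Data.Fin.Subset using (Subset; _∪_; _∩_; ⁅_⁆; ∣_∣; ⊥; ⊤; _⊆_)
open import Data.Vec using (take; drop; _++_)
open import Data.Product using (_×_)
open import Relation.Binary.PropositionalEquality using (_≡_)

Rank : ℕ → Set
Rank n = Subset n → ℕ

record IsMatroidRank {n : ℕ} (r : Rank n) : Set where
  field
    rank-≤-card : ∀ X → r X ≤ ∣ X ∣
    rank-mono   : ∀ X Y → X ⊆ Y → r X ≤ r Y
    rank-submod : ∀ X Y → r (X ∪ Y) + r (X ∩ Y) ≤ r X + r Y

record Matroid (n : ℕ) : Set where
  field
    rank    : Rank n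
    isRank  : IsMatroidRank rank
open Matroid public

totalRank : ∀ {n} → Rank n → ℕ
totalRank r = r ⊤

InClosure : ∀ {n} → Rank n → Subset n → Fin n → Set
InClosure r F e = r (F ∪ ⁅ e ⁆) ≡ r F

-- Q is a quotient of L (L is a lift of Q): cl_L(F) ⊆ cl_Q(F) for all F ⊆ E
IsQuotient : ∀ {n} → Rank n → Rank n → Set
IsQuotient {n} rQ rL = ∀ (F : Subset n) (e : Fin n) → InClosure rL F e → InClosure rQ F e

-- Direct sum M ⊕ N of M on S = Fin m and N on T = Fin n, as a matroid on
-- the disjoint union S ⊔ T = Fin (m + n) (S = first m, T = last n elements).
directSum : ∀ {m n} → Rank m → Rank n → Rank (m + n)
directSum {m} rM rN W = rM (take m W) + rN (drop m W)

-- i-th Higgs lift H^i_{Q,L} (i ∈ ℕ, so the case i < 0 does not arise):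
-- min(r_Q(W) + i, r_L(W)) for i ≤ r(L) - r(Q), and L for i > r(L) - r(Q).
higgsLift : ∀ {n} → ℕ → Rank n → Rank n → Rank n
higgsLift i rQ rL W =
  if i ≤ᵇ (totalRank rL ∸ totalRank rQ) then (rQ W + i) ⊓ rL W else rL W

restrictS : ∀ {m n} → Rank (m + n) → Rank m
restrictS {m} {n} rK X = rK (X ++ ⊥)

contractS : ∀ {m n} → Rank (m + n) → Rank n
contractS {m} {n} rK Y = rK (⊤ ++ Y) ∸ rK (⊤ {m} ++ ⊥ {n})

IsSemidirectSum : ∀ {m n} → Rank m → Rank n → Rank (m + n) → Set
IsSemidirectSum {m} {n} rM rN rK =
  IsMatroidRank rK
  × (∀ X → restrictS {m} {n} rK X ≡ rM X)
  × (∀ Y → contractS {m} {n} rK Y ≡ rN Y)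

module Submission where

-- The key fact about a quotient Q of L is the "gap inequality": for X ⊆ Y,
--   r_Q(Y) - r_Q(X) ≤ r_L(Y) - r_L(X).
-- It follows from the closure condition one element at a time (adding an
-- element raises r_Q by at most one, and raises r_Q only if it raises r_L),
-- and conversely it implies the closure condition.  Everything else is built
-- on it:
--   * gap inequalities add up over S ⊔ T, so Mq ⊕ N is a quotient of M ⊕ Nl;
--   * min(r_Q + i, r_L) is submodular, the mixed cases being exactly a gap
--     inequality, so every Higgs lift of a quotient pair is a matroid;
--   * here i ≤ r(L) - r(Q), so H^i = min(r_Q + i, r_L); on subsets of S the
--     gap inequality for Mq, M with r(M) = r(Mq) + i gives H^i|S = M, and on
--     sets S ∪ Y the first term of the minimum is r(M) + r_N(Y) ≤ r(M) + r_Nl(Y),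
--     so H^i/S = N.

open import Defs
open import Data.Nat using (ℕ; _+_)
open import Data.Product using (_×_)
open import Relation.Binary.PropositionalEquality using (_≡_)

open import Data.Nat using (zero; suc; _∸_; _≤_; _⊓_; _≤ᵇ_; s≤s⁻¹)
open import Data.Nat.Properties
open import Data.Nat.Tactic.RingSolver using (solve-∀)
open import Algebra.Properties.CommutativeSemigroup +-commutativeSemigroup
  using (interchange; xy∙z≈xz∙y)
open import Data.Bool using (Bool; true; false; if_then_else_; _∨_; _∧_)
open import Data.Fin using (Fin; zero; suc)
open import Data.Fin.Subset using (Subset; _∪_; _∩_; ⁅_⁆; ∣_∣; ⊥; ⊤; _⊆_; ⋃)
open import Data.Fin.Subset.Properties
  using (drop-∷-⊆; ⊥⊆; ⊆⊤; ∣⊥∣≡0; ∣⁅x⁆∣≡1; p⊆p∪q; ∪-identityˡ; ∪-identityʳ;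
         ∪-assoc; ∪-comm; ∩-comm; p∩q⊆q)
open import Data.Vec using (_∷_; []; take; drop; _++_; here)
open import Data.Vec.Properties using (take-zipWith; drop-zipWith)
open import Data.List using (List; []; _∷_; map)
open import Data.Product using (∃; _,_)
open import Data.Sum using (inj₁; inj₂)
open import Relation.Binary.PropositionalEquality
  using (refl; sym; trans; cong; cong₂; subst; subst₂; module ≡-Reasoning)
open import Relation.Nullary using (yes; no)

take-∪ : ∀ m {n} (p q : Subset (m + n)) → take m (p ∪ q) ≡ take m p ∪ take m q
take-∪ m = take-zipWith {m = m} _∨_

drop-∪ : ∀ m {n} (p q : Subset (m + n)) → drop m (p ∪ q) ≡ drop m p ∪ drop m q
drop-∪ m = drop-zipWith {m = m} _∨_

take-∩ : ∀ m {n} (p q : Subset (m + n)) → take m (p ∩ q) ≡ take m p ∩ take m q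
take-∩ m = take-zipWith {m = m} _∧_

drop-∩ : ∀ m {n} (p q : Subset (m + n)) → drop m (p ∩ q) ≡ drop m p ∩ drop m q
drop-∩ m = drop-zipWith {m = m} _∧_

take-++ : ∀ m {n} (p : Subset m) (q : Subset n) → take m (p ++ q) ≡ p
take-++ zero    []      q = refl
take-++ (suc m) (x ∷ p) q = cong (x ∷_) (take-++ m p q)

drop-++ : ∀ m {n} (p : Subset m) (q : Subset n) → drop m (p ++ q) ≡ q
drop-++ zero    []      q = refl
drop-++ (suc m) (x ∷ p) q = drop-++ m p q

⊤-++ : ∀ m {n} → ⊤ {m + n} ≡ ⊤ {m} ++ ⊤ {n}
⊤-++ zero    = refl
⊤-++ (suc m) = cong (true ∷_) (⊤-++ m)

∣∣-split : ∀ m {n} (p : Subset (m + n)) → ∣ p ∣ ≡ ∣ take m p ∣ + ∣ drop m p ∣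
∣∣-split zero    p          = refl
∣∣-split (suc m) (true ∷ p)  = cong suc (∣∣-split m p)
∣∣-split (suc m) (false ∷ p) = ∣∣-split m p

⊆⇒∪≡ : ∀ {n} {p q : Subset n} → p ⊆ q → p ∪ q ≡ q
⊆⇒∪≡ {p = []}        {[]}        _ = refl
⊆⇒∪≡ {p = true ∷ p}  {true ∷ q}  s = cong (true ∷_) (⊆⇒∪≡ (drop-∷-⊆ s))
⊆⇒∪≡ {p = true ∷ p}  {false ∷ q} s with s here
... | ()
⊆⇒∪≡ {p = false ∷ p} {y ∷ q}     s = cong (y ∷_) (⊆⇒∪≡ (drop-∷-⊆ s))

take-⊆ : ∀ m {n} {p q : Subset (m + n)} → p ⊆ q → take m p ⊆ take m q
take-⊆ m {p = p} {q} s =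
  subst (take m p ⊆_) (trans (sym (take-∪ m p q)) (cong (take m) (⊆⇒∪≡ s)))
        (p⊆p∪q (take m q))

drop-⊆ : ∀ m {n} {p q : Subset (m + n)} → p ⊆ q → drop m p ⊆ drop m q
drop-⊆ m {p = p} {q} s =
  subst (drop m p ⊆_) (trans (sym (drop-∪ m p q)) (cong (drop m) (⊆⇒∪≡ s)))
        (p⊆p∪q (drop m q))

-- Every subset is a finite union of singletons; this drives the
-- element-by-element induction behind the gap inequality.
⋃-singletons : ∀ {n} → List (Fin n) → Subset n
⋃-singletons l = ⋃ (map ⁅_⁆ l)

⋃-singletons-suc : ∀ {n} (l : List (Fin n)) →
  ⋃-singletons (map suc l) ≡ false ∷ ⋃-singletons l
⋃-singletons-suc []      = refl
⋃-singletons-suc (e ∷ l) = cong (λ p → ⁅ suc e ⁆ ∪ p) (⋃-singletons-suc l)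

enumerate : ∀ {n} (p : Subset n) → ∃ λ (l : List (Fin n)) → ⋃-singletons l ≡ p
enumerate []          = [] , refl
enumerate (false ∷ p) with enumerate p
... | l , eq = map suc l , trans (⋃-singletons-suc l) (cong (false ∷_) eq)
enumerate (true ∷ p)  with enumerate p
... | l , eq = zero ∷ map suc l ,
  trans (cong (⁅ zero ⁆ ∪_) (⋃-singletons-suc l))
        (cong (true ∷_) (trans (∪-identityˡ _) eq))

module _ {k} {r : Rank k} (R : IsMatroidRank r) where
  open IsMatroidRank R

  rank-⊥ : r ⊥ ≡ 0
  rank-⊥ = n≤0⇒n≡0 (≤-trans (rank-≤-card ⊥) (≤-reflexive (∣⊥∣≡0 k)))

  rank-add : ∀ Z e → r (Z ∪ ⁅ e ⁆) ≤ suc (r Z)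
  rank-add Z e = begin
    r (Z ∪ ⁅ e ⁆)                  ≤⟨ m≤m+n _ _ ⟩
    r (Z ∪ ⁅ e ⁆) + r (Z ∩ ⁅ e ⁆)  ≤⟨ rank-submod Z ⁅ e ⁆ ⟩
    r Z + r ⁅ e ⁆                  ≤⟨ +-monoʳ-≤ (r Z) r⁅e⁆≤1 ⟩
    r Z + 1                        ≡⟨ +-comm (r Z) 1 ⟩
    suc (r Z)                      ∎
    where
    open ≤-Reasoning
    r⁅e⁆≤1 : r ⁅ e ⁆ ≤ 1
    r⁅e⁆≤1 = ≤-trans (rank-≤-card ⁅ e ⁆) (≤-reflexive (∣⁅x⁆∣≡1 e))

-- Gap rQ rL X Y  says  r_Q(Y) - r_Q(X) ≤ r_L(Y) - r_L(X), written without ∸.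
Gap : ∀ {k} → Rank k → Rank k → Subset k → Subset k → Set
Gap rQ rL X Y = rQ Y + rL X ≤ rL Y + rQ X

+-chain : ∀ {a b c d e f} → a + b ≤ c + d → d + e ≤ b + f → a + e ≤ c + f
+-chain {a} {b} {c} {d} {e} {f} p q =
  +-cancelˡ-≤ (b + d) _ _
    (subst₂ _≤_ (regroupˡ a b d e) (regroupʳ c d b f) (+-mono-≤ p q))
  where
  regroupˡ : ∀ w x y z → (w + x) + (y + z) ≡ (x + y) + (w + z)
  regroupˡ = solve-∀
  regroupʳ : ∀ w x y z → (w + x) + (y + z) ≡ (y + x) + (w + z)
  regroupʳ = solve-∀

module GapLaws {k} (rQ rL : Rank k) where

  gap-refl : ∀ X → Gap rQ rL X X
  gap-refl X = ≤-reflexive (+-comm (rQ X) (rL X))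

  gap-trans : ∀ X Y Z → Gap rQ rL X Y → Gap rQ rL Y Z → Gap rQ rL X Z
  gap-trans X Y Z XY YZ = +-chain {rQ Z} {rL Y} {rL Z} {rQ Y} {rL X} {rQ X} YZ XY

-- A rank function with the gap property is a quotient: if e ∈ cl_L(F) the
-- gap from F to F ∪ {e} forces r_Q(F ∪ {e}) ≤ r_Q(F).
gap⇒quotient : ∀ {k} {rQ rL : Rank k} →
  IsMatroidRank rQ → (∀ X Y → X ⊆ Y → Gap rQ rL X Y) → IsQuotient rQ rL
gap⇒quotient {rQ = rQ} {rL} MQ gap F e e∈clL =
  ≤-antisym (+-cancelʳ-≤ (rL F) _ _ gapF)
            (IsMatroidRank.rank-mono MQ F (F ∪ ⁅ e ⁆) (p⊆p∪q ⁅ e ⁆))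
  where
  gapF : rQ (F ∪ ⁅ e ⁆) + rL F ≤ rQ F + rL F
  gapF = subst (rQ (F ∪ ⁅ e ⁆) + rL F ≤_)
               (trans (cong (_+ rQ F) e∈clL) (+-comm (rL F) (rQ F)))
               (gap F (F ∪ ⁅ e ⁆) (p⊆p∪q ⁅ e ⁆))

module Quotient {k} {rQ rL : Rank k}
                (MQ : IsMatroidRank rQ) (ML : IsMatroidRank rL) (Q⊑L : IsQuotient rQ rL) where
  open GapLaws rQ rL

  -- One element: either e ∈ cl_L(Z), so also e ∈ cl_Q(Z) and both gaps are 0,
  -- or r_L goes up by one while r_Q goes up by at most one.
  gap-add : ∀ Z e → Gap rQ rL Z (Z ∪ ⁅ e ⁆)
  gap-add Z e with rL (Z ∪ ⁅ e ⁆) ≟ rL Z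
  ... | yes e∈clL = subst₂ (λ a b → a + rL Z ≤ b + rQ Z)
                           (sym (Q⊑L Z e e∈clL)) (sym e∈clL) (gap-refl Z)
  ... | no  e∉clL = begin
    rQ (Z ∪ ⁅ e ⁆) + rL Z  ≤⟨ s≤s⁻¹ grow ⟩
    rQ Z + rL (Z ∪ ⁅ e ⁆)  ≡⟨ +-comm (rQ Z) _ ⟩
    rL (Z ∪ ⁅ e ⁆) + rQ Z  ∎
    where
    open ≤-Reasoning
    rL-up : suc (rL Z) ≤ rL (Z ∪ ⁅ e ⁆)
    rL-up = ≤∧≢⇒< (IsMatroidRank.rank-mono ML Z (Z ∪ ⁅ e ⁆) (p⊆p∪q ⁅ e ⁆))
                  (λ eq → e∉clL (sym eq))
    grow : suc (rQ (Z ∪ ⁅ e ⁆) + rL Z) ≤ suc (rQ Z + rL (Z ∪ ⁅ e ⁆))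
    grow = subst (_≤ suc (rQ Z + rL (Z ∪ ⁅ e ⁆))) (+-suc _ (rL Z))
                 (+-mono-≤ (rank-add MQ Z e) rL-up)

  gap-⋃ : ∀ X l → Gap rQ rL X (X ∪ ⋃-singletons l)
  gap-⋃ X []      = subst (Gap rQ rL X) (sym (∪-identityʳ X)) (gap-refl X)
  gap-⋃ X (e ∷ l) = subst (Gap rQ rL X) regroup
                          (gap-trans X _ _ (gap-⋃ X l) (gap-add (X ∪ ⋃-singletons l) e))
    where
    regroup : (X ∪ ⋃-singletons l) ∪ ⁅ e ⁆ ≡ X ∪ (⁅ e ⁆ ∪ ⋃-singletons l)
    regroup = trans (∪-assoc X _ ⁅ e ⁆) (cong (X ∪_) (∪-comm _ ⁅ e ⁆))

  -- The gap inequality for a quotient: Y is X together with its own elements.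
  quotient⇒gap : ∀ X Y → X ⊆ Y → Gap rQ rL X Y
  quotient⇒gap X Y X⊆Y with enumerate Y
  ... | l , eq = subst (Gap rQ rL X) (trans (cong (X ∪_) eq) (⊆⇒∪≡ X⊆Y)) (gap-⋃ X l)

  -- The gap from ∅: a quotient has pointwise smaller rank.
  quotient⇒rank≤ : ∀ Y → rQ Y ≤ rL Y
  quotient⇒rank≤ Y = subst₂ _≤_ (drop-⊥ rQ (rank-⊥ ML)) (drop-⊥ rL (rank-⊥ MQ))
                                (quotient⇒gap ⊥ Y ⊥⊆)
    where
    drop-⊥ : (r : Rank k) {a : ℕ} → a ≡ 0 → r Y + a ≡ r Y
    drop-⊥ r refl = +-identityʳ (r Y)

module _ {m n} (rA : Rank m) (rB : Rank n) where

  directSum-++ : ∀ (p : Subset m) (q : Subset n) → directSum rA rB (p ++ q) ≡ rA p + rB q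
  directSum-++ p q = cong₂ _+_ (cong rA (take-++ m p q)) (cong rB (drop-++ m p q))

  directSum-⊤ : totalRank (directSum rA rB) ≡ totalRank rA + totalRank rB
  directSum-⊤ = trans (cong (directSum rA rB) (⊤-++ m)) (directSum-++ ⊤ ⊤)

  directSum-++⊥ : IsMatroidRank rB → ∀ p → directSum rA rB (p ++ ⊥) ≡ rA p
  directSum-++⊥ RB p = trans (directSum-++ p ⊥)
                             (trans (cong (rA p +_) (rank-⊥ RB)) (+-identityʳ (rA p)))

directSum-isMatroid : ∀ {m n} {rA : Rank m} {rB : Rank n} →
  IsMatroidRank rA → IsMatroidRank rB → IsMatroidRank (directSum rA rB)
directSum-isMatroid {m} {n} {rA} {rB} RA RB = record
  { rank-≤-card = λ X → subst (directSum rA rB X ≤_) (sym (∣∣-split m X))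
                    (+-mono-≤ (A.rank-≤-card (take m X)) (B.rank-≤-card (drop m X)))
  ; rank-mono   = λ X Y X⊆Y → +-mono-≤ (A.rank-mono _ _ (take-⊆ m X⊆Y))
                                       (B.rank-mono _ _ (drop-⊆ m X⊆Y))
  ; rank-submod = submod
  }
  where
  module A = IsMatroidRank RA
  module B = IsMatroidRank RB
  submod : ∀ X Y → directSum rA rB (X ∪ Y) + directSum rA rB (X ∩ Y)
                   ≤ directSum rA rB X + directSum rA rB Y
  submod X Y = begin
    directSum rA rB (X ∪ Y) + directSum rA rB (X ∩ Y)
      ≡⟨ cong₂ _+_ (cong₂ _+_ (cong rA (take-∪ m X Y)) (cong rB (drop-∪ m X Y)))
                   (cong₂ _+_ (cong rA (take-∩ m X Y)) (cong rB (drop-∩ m X Y))) ⟩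
    (rA (Xₛ ∪ Yₛ) + rB (Xₜ ∪ Yₜ)) + (rA (Xₛ ∩ Yₛ) + rB (Xₜ ∩ Yₜ))
      ≡⟨ interchange (rA (Xₛ ∪ Yₛ)) (rB (Xₜ ∪ Yₜ)) (rA (Xₛ ∩ Yₛ)) (rB (Xₜ ∩ Yₜ)) ⟩
    (rA (Xₛ ∪ Yₛ) + rA (Xₛ ∩ Yₛ)) + (rB (Xₜ ∪ Yₜ) + rB (Xₜ ∩ Yₜ))
      ≤⟨ +-mono-≤ (A.rank-submod Xₛ Yₛ) (B.rank-submod Xₜ Yₜ) ⟩
    (rA Xₛ + rA Yₛ) + (rB Xₜ + rB Yₜ)
      ≡⟨ interchange (rA Xₛ) (rA Yₛ) (rB Xₜ) (rB Yₜ) ⟩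
    directSum rA rB X + directSum rA rB Y ∎
    where
    open ≤-Reasoning
    Xₛ Yₛ : Subset m
    Xₛ = take m X
    Yₛ = take m Y
    Xₜ Yₜ : Subset n
    Xₜ = drop m X
    Yₜ = drop m Y

directSum-gap : ∀ {m n} {qA lA : Rank m} {qB lB : Rank n} (X Y : Subset (m + n)) →
  Gap qA lA (take m X) (take m Y) → Gap qB lB (drop m X) (drop m Y) →
  Gap (directSum qA qB) (directSum lA lB) X Y
directSum-gap {m} {n} {qA = qA} {lA} {qB} {lB} X Y gapS gapT = begin
  (qA Yₛ + qB Yₜ) + (lA Xₛ + lB Xₜ)  ≡⟨ interchange (qA Yₛ) (qB Yₜ) (lA Xₛ) (lB Xₜ) ⟩
  (qA Yₛ + lA Xₛ) + (qB Yₜ + lB Xₜ)  ≤⟨ +-mono-≤ gapS gapT ⟩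
  (lA Yₛ + qA Xₛ) + (lB Yₜ + qB Xₜ)  ≡⟨ interchange (lA Yₛ) (qA Xₛ) (lB Yₜ) (qB Xₜ) ⟩
  (lA Yₛ + lB Yₜ) + (qA Xₛ + qB Xₜ)  ∎
  where
  open ≤-Reasoning
  Xₛ Yₛ : Subset m
  Xₛ = take m X
  Yₛ = take m Y
  Xₜ Yₜ : Subset n
  Xₜ = drop m X
  Yₜ = drop m Y

directSum-quotient : ∀ {m n} {qA lA : Rank m} {qB lB : Rank n} →
  IsMatroidRank qA → IsMatroidRank lA → IsQuotient qA lA →
  IsMatroidRank qB → IsMatroidRank lB → IsQuotient qB lB →
  IsQuotient (directSum qA qB) (directSum lA lB)
directSum-quotient {m} {qA = qA} {lA} {qB} {lB} QA LA qa QB LB qb =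
  gap⇒quotient (directSum-isMatroid QA QB) λ X Y X⊆Y →
    directSum-gap {qA = qA} {lA} {qB} {lB} X Y
      (A.quotient⇒gap _ _ (take-⊆ m X⊆Y)) (B.quotient⇒gap _ _ (drop-⊆ m X⊆Y))
  where
  module A = Quotient QA LA qa
  module B = Quotient QB LB qb

truncatedRank : ∀ {k} → ℕ → Rank k → Rank k → Rank k
truncatedRank i rQ rL W = (rQ W + i) ⊓ rL W

module Truncation {k} {rQ rL : Rank k}
                  (MQ : IsMatroidRank rQ) (ML : IsMatroidRank rL) (Q⊑L : IsQuotient rQ rL)
                  (i : ℕ) where
  private
    module Q = IsMatroidRank MQ
    module L = IsMatroidRank ML

    h : Rank k
    h = truncatedRank i rQ rL

    h≤Q : ∀ W → h W ≤ rQ W + i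
    h≤Q W = m⊓n≤m (rQ W + i) (rL W)

    h≤L : ∀ W → h W ≤ rL W
    h≤L W = m⊓n≤n (rQ W + i) (rL W)

  -- Submodularity when the minimum is attained by Q on X and by L on Y:
  -- submodularity of r_Q combined with the gap from X ∩ Y to Y.
  submod-mixed : ∀ X Y → h X ≡ rQ X + i → h Y ≡ rL Y → h (X ∪ Y) + h (X ∩ Y) ≤ h X + h Y
  submod-mixed X Y hX hY = begin
    h (X ∪ Y) + h (X ∩ Y)          ≤⟨ +-mono-≤ (h≤Q (X ∪ Y)) (h≤L (X ∩ Y)) ⟩
    (rQ (X ∪ Y) + i) + rL (X ∩ Y)  ≡⟨ xy∙z≈xz∙y (rQ (X ∪ Y)) i (rL (X ∩ Y)) ⟩
    (rQ (X ∪ Y) + rL (X ∩ Y)) + i  ≤⟨ +-monoˡ-≤ i exchange ⟩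
    (rQ X + rL Y) + i              ≡⟨ xy∙z≈xz∙y (rQ X) (rL Y) i ⟩
    (rQ X + i) + rL Y              ≡⟨ sym (cong₂ _+_ hX hY) ⟩
    h X + h Y                      ∎
    where
    open ≤-Reasoning
    gapY : rQ Y + rL (X ∩ Y) ≤ rQ (X ∩ Y) + rL Y
    gapY = subst (rQ Y + rL (X ∩ Y) ≤_) (+-comm (rL Y) _)
                 (Quotient.quotient⇒gap MQ ML Q⊑L (X ∩ Y) Y (p∩q⊆q X Y))
    exchange : rQ (X ∪ Y) + rL (X ∩ Y) ≤ rQ X + rL Y
    exchange = +-chain {rQ (X ∪ Y)} {rQ (X ∩ Y)} {rQ X} {rQ Y} {rL (X ∩ Y)} {rL Y}
                       (Q.rank-submod X Y) gapY

  submod-Q : ∀ X Y → h X ≡ rQ X + i → h Y ≡ rQ Y + i → h (X ∪ Y) + h (X ∩ Y) ≤ h X + h Y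
  submod-Q X Y hX hY = begin
    h (X ∪ Y) + h (X ∩ Y)                ≤⟨ +-mono-≤ (h≤Q (X ∪ Y)) (h≤Q (X ∩ Y)) ⟩
    (rQ (X ∪ Y) + i) + (rQ (X ∩ Y) + i)  ≡⟨ interchange (rQ (X ∪ Y)) i (rQ (X ∩ Y)) i ⟩
    (rQ (X ∪ Y) + rQ (X ∩ Y)) + (i + i)  ≤⟨ +-monoˡ-≤ (i + i) (Q.rank-submod X Y) ⟩
    (rQ X + rQ Y) + (i + i)              ≡⟨ interchange (rQ X) (rQ Y) i i ⟩
    (rQ X + i) + (rQ Y + i)              ≡⟨ sym (cong₂ _+_ hX hY) ⟩
    h X + h Y                            ∎
    where open ≤-Reasoning

  submod-L : ∀ X Y → h X ≡ rL X → h Y ≡ rL Y → h (X ∪ Y) + h (X ∩ Y) ≤ h X + h Y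
  submod-L X Y hX hY = begin
    h (X ∪ Y) + h (X ∩ Y)    ≤⟨ +-mono-≤ (h≤L (X ∪ Y)) (h≤L (X ∩ Y)) ⟩
    rL (X ∪ Y) + rL (X ∩ Y)  ≤⟨ L.rank-submod X Y ⟩
    rL X + rL Y              ≡⟨ sym (cong₂ _+_ hX hY) ⟩
    h X + h Y                ∎
    where open ≤-Reasoning

  truncation-isMatroid : IsMatroidRank h
  truncation-isMatroid = record
    { rank-≤-card = λ X → ≤-trans (h≤L X) (L.rank-≤-card X)
    ; rank-mono   = λ X Y X⊆Y → ⊓-mono-≤ (+-monoˡ-≤ i (Q.rank-mono X Y X⊆Y)) (L.rank-mono X Y X⊆Y)
    ; rank-submod = submod
    }
    where
    -- The remaining mixed case is the first one with X and Y exchanged.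
    submod : ∀ X Y → h (X ∪ Y) + h (X ∩ Y) ≤ h X + h Y
    submod X Y with ⊓-sel (rQ X + i) (rL X) | ⊓-sel (rQ Y + i) (rL Y)
    ... | inj₁ hX | inj₁ hY = submod-Q X Y hX hY
    ... | inj₂ hX | inj₂ hY = submod-L X Y hX hY
    ... | inj₁ hX | inj₂ hY = submod-mixed X Y hX hY
    ... | inj₂ hX | inj₁ hY =
      subst₂ _≤_ (cong₂ _+_ (cong h (∪-comm Y X)) (cong h (∩-comm Y X))) (+-comm (h Y) (h X))
             (submod-mixed Y X hY hX)

higgsLift-truncated : ∀ {k} {i} (rQ rL : Rank k) → i ≤ totalRank rL ∸ totalRank rQ →
  ∀ W → higgsLift i rQ rL W ≡ truncatedRank i rQ rL W
higgsLift-truncated {i = i} rQ rL i≤ W with i ≤ᵇ (totalRank rL ∸ totalRank rQ) | ≤⇒≤ᵇ i≤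
... | true  | _  = refl
... | false | ()

higgsLift-isMatroid : ∀ {k} {rQ rL : Rank k} (i : ℕ) →
  IsMatroidRank rQ → IsMatroidRank rL → IsQuotient rQ rL → IsMatroidRank (higgsLift i rQ rL)
higgsLift-isMatroid {rQ = rQ} {rL} i MQ ML Q⊑L =
  choose (i ≤ᵇ (totalRank rL ∸ totalRank rQ)) (Truncation.truncation-isMatroid MQ ML Q⊑L i) ML
  where
  choose : ∀ (b : Bool) {f g : Rank _} → IsMatroidRank f → IsMatroidRank g →
           IsMatroidRank (λ W → if b then f W else g W)
  choose true  F G = F
  choose false F G = G

module HiggsOfDirectSum {m n} (M Mq : Matroid m) (N Nl : Matroid n) (i : ℕ)
       (Mq⊑M : IsQuotient (rank Mq) (rank M))
       (rank-gap : totalRank (rank Mq) + i ≡ totalRank (rank M))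
       (N⊑Nl : IsQuotient (rank N) (rank Nl)) where
  private
    rM rMq : Rank m
    rM = rank M
    rMq = rank Mq
    rN rNl : Rank n
    rN = rank N
    rNl = rank Nl
    module QM = Quotient (isRank Mq) (isRank M) Mq⊑M
    module QN = Quotient (isRank N) (isRank Nl) N⊑Nl

  rQ rL : Rank (m + n)
  rQ = directSum rMq rN
  rL = directSum rM rNl

  Q⊑L : IsQuotient rQ rL
  Q⊑L = directSum-quotient (isRank Mq) (isRank M) Mq⊑M (isRank N) (isRank Nl) N⊑Nl

  H : Rank (m + n)
  H = higgsLift i rQ rL

  H-isMatroid : IsMatroidRank H
  H-isMatroid = higgsLift-isMatroid i (directSum-isMatroid (isRank Mq) (isRank N))
                                      (directSum-isMatroid (isRank M) (isRank Nl)) Q⊑L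

  -- i ≤ r(L) - r(Q), since r(Q) + i = r(M) + r(N) ≤ r(M) + r(Nl).
  i≤rankDifference : i ≤ totalRank rL ∸ totalRank rQ
  i≤rankDifference = m+n≤o⇒m≤o∸n i (begin
    i + totalRank rQ    ≡⟨ cong (i +_) (directSum-⊤ rMq rN) ⟩
    i + (rMq ⊤ + rN ⊤)  ≡⟨ sym (+-assoc i (rMq ⊤) (rN ⊤)) ⟩
    (i + rMq ⊤) + rN ⊤  ≡⟨ cong (_+ rN ⊤) (trans (+-comm i (rMq ⊤)) rank-gap) ⟩
    rM ⊤ + rN ⊤         ≤⟨ +-monoʳ-≤ (rM ⊤) (QN.quotient⇒rank≤ ⊤) ⟩
    rM ⊤ + rNl ⊤        ≡⟨ sym (directSum-⊤ rM rNl) ⟩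
    totalRank rL        ∎)
    where open ≤-Reasoning

  H≡truncated : ∀ W → H W ≡ (rQ W + i) ⊓ rL W
  H≡truncated = higgsLift-truncated rQ rL i≤rankDifference

  -- r_M(X) ≤ r_Mq(X) + i: the gap from X to S for the quotient Mq of M.
  rM≤rMq+i : ∀ X → rM X ≤ rMq X + i
  rM≤rMq+i X = +-cancelˡ-≤ (rMq ⊤) _ _ (begin
    rMq ⊤ + rM X         ≤⟨ QM.quotient⇒gap X ⊤ ⊆⊤ ⟩
    rM ⊤ + rMq X         ≡⟨ cong (_+ rMq X) (sym rank-gap) ⟩
    (rMq ⊤ + i) + rMq X  ≡⟨ +-assoc (rMq ⊤) i (rMq X) ⟩
    rMq ⊤ + (i + rMq X)  ≡⟨ cong (rMq ⊤ +_) (+-comm i (rMq X)) ⟩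
    rMq ⊤ + (rMq X + i)  ∎)
    where open ≤-Reasoning

  H|S≡M : ∀ X → restrictS {m} {n} H X ≡ rM X
  H|S≡M X = begin
    H (X ++ ⊥)                       ≡⟨ H≡truncated (X ++ ⊥) ⟩
    (rQ (X ++ ⊥) + i) ⊓ rL (X ++ ⊥)  ≡⟨ cong₂ (λ a b → (a + i) ⊓ b) onQ onL ⟩
    (rMq X + i) ⊓ rM X               ≡⟨ m≥n⇒m⊓n≡n (rM≤rMq+i X) ⟩
    rM X                             ∎
    where
    open ≡-Reasoning
    onQ : rQ (X ++ ⊥) ≡ rMq X
    onQ = directSum-++⊥ rMq rN (isRank N) X
    onL : rL (X ++ ⊥) ≡ rM X
    onL = directSum-++⊥ rM rNl (isRank Nl) X

  H-on-S∪ : ∀ Y → H (⊤ ++ Y) ≡ rM ⊤ + rN Y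
  H-on-S∪ Y = begin
    H (⊤ ++ Y)                             ≡⟨ H≡truncated (⊤ ++ Y) ⟩
    (rQ (⊤ ++ Y) + i) ⊓ rL (⊤ ++ Y)        ≡⟨ cong₂ (λ a b → (a + i) ⊓ b) onQ onL ⟩
    ((rMq ⊤ + rN Y) + i) ⊓ (rM ⊤ + rNl Y)  ≡⟨ cong (_⊓ (rM ⊤ + rNl Y)) first ⟩
    (rM ⊤ + rN Y) ⊓ (rM ⊤ + rNl Y)         ≡⟨ m≤n⇒m⊓n≡m N≤Nl ⟩
    rM ⊤ + rN Y                            ∎
    where
    open ≡-Reasoning
    onQ : rQ (⊤ ++ Y) ≡ rMq ⊤ + rN Y
    onQ = directSum-++ rMq rN ⊤ Y
    onL : rL (⊤ ++ Y) ≡ rM ⊤ + rNl Y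
    onL = directSum-++ rM rNl ⊤ Y
    first : (rMq ⊤ + rN Y) + i ≡ rM ⊤ + rN Y
    first = trans (xy∙z≈xz∙y (rMq ⊤) (rN Y) i) (cong (_+ rN Y) rank-gap)
    N≤Nl : rM ⊤ + rN Y ≤ rM ⊤ + rNl Y
    N≤Nl = +-monoʳ-≤ (rM ⊤) (QN.quotient⇒rank≤ Y)

  H/S≡N : ∀ Y → contractS {m} {n} H Y ≡ rN Y
  H/S≡N Y = begin
    H (⊤ {m} ++ Y) ∸ H (⊤ {m} ++ ⊥ {n})  ≡⟨ cong₂ _∸_ (H-on-S∪ Y) (H-on-S∪ ⊥) ⟩
    (rM ⊤ + rN Y) ∸ (rM ⊤ + rN ⊥)        ≡⟨ [m+n]∸[m+o]≡n∸o (rM ⊤) (rN Y) (rN ⊥) ⟩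
    rN Y ∸ rN ⊥                          ≡⟨ cong (rN Y ∸_) (rank-⊥ (isRank N)) ⟩
    rN Y                                 ∎
    where open ≡-Reasoning

theorem4p3 : (m n : ℕ) (M Mq : Matroid m) (N Nl : Matroid n) (i : ℕ)
    → IsQuotient (rank Mq) (rank M)
    → totalRank (rank Mq) + i ≡ totalRank (rank M)
    → IsQuotient (rank N) (rank Nl)
    → IsQuotient (directSum (rank Mq) (rank N)) (directSum (rank M) (rank Nl))
      × IsSemidirectSum (rank M) (rank N)
          (higgsLift i (directSum (rank Mq) (rank N)) (directSum (rank M) (rank Nl)))
theorem4p3 m n M Mq N Nl i Mq⊑M rank-gap N⊑Nl = Q⊑L , H-isMatroid , H|S≡M , H/S≡N
  where open HiggsOfDirectSum M Mq N Nl i Mq⊑M rank-gap N⊑Nl
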